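{- Fix $r\ge2$. Let $M$ be a graph such that for every $k\in\mathbb N$ there is an infinite collection of pairwise disjoint finite vertex sets $A,B_0,B_1,B_2,\dots$ of $M$ and subsets $C_i\subseteq B_i$ with the following properties: (i) $|A|=k$; (ii) for every $i$ there is a bijection $f_i:A\to C_i$ such that for $a\in A$, $c\in C_i$, $ac$ is an edge iff $c=f_i(a)$ (a semi-induced matching between $A$ and $C_i$); (iii) for every $i$ there are no edges between $A$ and $B_i\setminus C_i$; (iv) there are no edges between $B_i\setminus C_i$ and $B_j$ for $i\ne j$; (v) for every $i$ and every pair of distinct vertices $u,v\in C_i$ there is a path of length at least $2$ and at most $r$ connecting $u$ and $v$ all of whose internal vertices belong to $B_i\setminus C_i$. Then $M$ is not pattern-free.
   Context: For a structure $\widehat G$ and formula $\varphi(x,y)$, $\varphi(\widehat G)$ is the graph on $V(\widehat G)$ with edges $uv$, $u\ne v$, with $\widehat G\models\varphi(u,v)\lor\varphi(v,u)$. The $s$-subdivision replaces each edge by a path of length $s+1$. A graph $M$ is pattern-free if for every $s\ge1$, every class $\widehat{\mathscr C}$ of expansions of $M$ by unary predicates (fixed signature) and every quantifier-free $\varphi(x,y)$ there is $n$ such that for no $\widehat M\in\widehat{\mathscr C}$ does $\varphi(\widehat M)$ contain the $s$-subdivision of $K_n$ as an induced subgraph. -}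

module Defs where

open import Level using (0ℓ) renaming (suc to lsuc)
open import Data.Nat using (ℕ; zero; suc; _≤_; _<_)
open import Data.Fin using (Fin; toℕ; fromℕ)
import Data.Fin as F
open import Data.Product using (Σ; ∃; ∃-syntax; _×_; _,_)
open import Data.Sum using (_⊎_)
open import Data.Empty using (⊥)
open import Data.Unit using (⊤)
open import Data.List using (List)
open import Data.List.Membership.Propositional using (_∈_; _∉_)
open import Relation.Nullary using (¬_)
open import Relation.Binary.PropositionalEquality using (_≡_; _≢_)
open import Function.Definitions using (Injective)

record Graph : Set₁ where
  field
    V     : Set
    E     : V → V → Set
    sym   : ∀ {u v} → E u v → E v u
    irrefl : ∀ {u} → ¬ E u u

open Graph public

InducedSub : Graph → Graph → Set
InducedSub H G =
  Σ (V H → V G) λ h →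
    Injective _≡_ _≡_ h ×
    (∀ u v → (E H u v → E G (h u) (h v)) × (E G (h u) (h v) → E H u v))

-- The s-subdivision of K_n: branch vertices Fin n; for each pair
-- i < j, s subdivision vertices sub i j _ t (t : Fin s), forming the path
--   br i — sub i j _ 0 — sub i j _ 1 — … — sub i j _ (s-1) — br j
-- (for s = 0 this is the edge br i — br j).

data SubV (n s : ℕ) : Set where
  br  : Fin n → SubV n s
  sub : (i j : Fin n) → i F.< j → Fin s → SubV n s

data SubArc (n s : ℕ) : SubV n s → SubV n s → Set where
  direct : ∀ {i j} → i F.< j → s ≡ 0 → SubArc n s (br i) (br j)
  first  : ∀ {i j p t} → toℕ t ≡ 0 → SubArc n s (br i) (sub i j p t)
  mid    : ∀ {i j p t t'} → suc (toℕ t) ≡ toℕ t' →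
           SubArc n s (sub i j p t) (sub i j p t')
  last   : ∀ {i j p t} → suc (toℕ t) ≡ s → SubArc n s (sub i j p t) (br j)

SubEdge : (n s : ℕ) → SubV n s → SubV n s → Set
SubEdge n s u v = SubArc n s u v ⊎ SubArc n s v u

Expansion : Graph → ℕ → Set₁
Expansion M m = Fin m → V M → Set

data QF (m : ℕ) : Set where
  eqA   : Fin 2 → Fin 2 → QF m
  edgeA : Fin 2 → Fin 2 → QF m
  predA : Fin m → Fin 2 → QF m
  tt ff : QF m
  neg   : QF m → QF m
  _and_ _or_ : QF m → QF m → QF m

-- satisfaction in the expansion (M,P) under an assignment ρ of x (=0), y (=1)
Sat : (M : Graph) {m : ℕ} → Expansion M m → QF m → (Fin 2 → V M) → Set
Sat M P (eqA a b)   ρ = ρ a ≡ ρ b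
Sat M P (edgeA a b) ρ = E M (ρ a) (ρ b)
Sat M P (predA j a) ρ = P j (ρ a)
Sat M P tt          ρ = ⊤
Sat M P ff          ρ = ⊥
Sat M P (neg φ)     ρ = ¬ Sat M P φ ρ
Sat M P (φ and ψ)   ρ = Sat M P φ ρ × Sat M P ψ ρ
Sat M P (φ or ψ)    ρ = Sat M P φ ρ ⊎ Sat M P ψ ρ

[_,_] : {A : Set} → A → A → Fin 2 → A
[ u , v ] Fin.zero = u
[ u , v ] (Fin.suc _) = v

interpG : (M : Graph) {m : ℕ} → Expansion M m → QF m → Graph
interpG M P φ = record
  { V = V M
  ; E = λ u v → (u ≢ v) × (Sat M P φ [ u , v ] ⊎ Sat M P φ [ v , u ])
  ; sym = λ { (ne , Data.Sum.inj₁ x) → (λ e → ne (Relation.Binary.PropositionalEquality.sym e)) , Data.Sum.inj₂ x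
            ; (ne , Data.Sum.inj₂ x) → (λ e → ne (Relation.Binary.PropositionalEquality.sym e)) , Data.Sum.inj₁ x }
  ; irrefl = λ { (ne , _) → ne Relation.Binary.PropositionalEquality.refl }
  }

SubK : ℕ → ℕ → Graph
SubK n s = record
  { V = SubV n s
  ; E = SubEdge n s
  ; sym = λ { (Data.Sum.inj₁ x) → Data.Sum.inj₂ x ; (Data.Sum.inj₂ x) → Data.Sum.inj₁ x }
  ; irrefl = irr
  }
  where
  open import Data.Nat.Properties using (1+n≢n)
  open import Data.Fin.Properties using (<-irrefl)
  open import Relation.Binary.PropositionalEquality using (refl; sym)
  arc-irr : ∀ {u} → ¬ SubArc n s u u
  arc-irr (direct p _) = <-irrefl refl p
  arc-irr (mid e) = 1+n≢n e
  irr : ∀ {u} → ¬ SubEdge n s u u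
  irr (Data.Sum.inj₁ a) = arc-irr a
  irr (Data.Sum.inj₂ a) = arc-irr a

PatternFree : Graph → Set₂
PatternFree M =
  (s : ℕ) → 1 ≤ s →
  (m : ℕ) → (𝒞 : Expansion M m → Set₁) → (φ : QF m) →
  ∃[ n ] ((P : Expansion M m) → 𝒞 P → ¬ InducedSub (SubK n s) (interpG M P φ))

record Path (M : Graph) (ℓ : ℕ) (u v : V M) : Set where
  field
    vtx    : Fin (suc ℓ) → V M
    inj    : Injective _≡_ _≡_ vtx
    start  : vtx Fin.zero ≡ u
    end    : vtx (fromℕ ℓ) ≡ v
    adj    : ∀ (t t' : Fin (suc ℓ)) → suc (toℕ t) ≡ toℕ t' → E M (vtx t) (vtx t')

InternalIn : {M : Graph} {ℓ : ℕ} {u v : V M} → Path M ℓ u v → (V M → Set) → Set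
InternalIn {ℓ = ℓ} p Q = ∀ (t : Fin (suc ℓ)) → 0 < toℕ t → toℕ t < ℓ → Q (Path.vtx p t)

-- A is given as an injective map a : Fin k → V (so |A| = k, A = image a);
-- B i, C i are finite sets given as lists; f i : Fin k → V represents the
-- bijection f_i : A → C_i via a t ↦ f i t.

record Config (r : ℕ) (M : Graph) (k : ℕ) : Set where
  field
    a     : Fin k → V M
    a-inj : Injective _≡_ _≡_ a
    B C   : ℕ → List (V M)
    C⊆B   : ∀ i {v} → v ∈ C i → v ∈ B i
    A∩B   : ∀ i t → a t ∉ B i
    B∩B   : ∀ i j → i ≢ j → ∀ {v} → v ∈ B i → v ∉ B j
    f      : ℕ → Fin k → V M
    f-inj  : ∀ i → Injective _≡_ _≡_ (f i)
    f-into : ∀ i t → f i t ∈ C i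
    f-onto : ∀ i {c} → c ∈ C i → ∃[ t ] f i t ≡ c
    match  : ∀ i t {c} → c ∈ C i → (E M (a t) c → c ≡ f i t) × (c ≡ f i t → E M (a t) c)
    noAB   : ∀ i t {v} → v ∈ B i → v ∉ C i → ¬ E M (a t) v
    noBB   : ∀ i j → i ≢ j → ∀ {u v} → u ∈ B i → u ∉ C i → v ∈ B j → ¬ E M u v
    paths  : ∀ i {u v} → u ∈ C i → v ∈ C i → u ≢ v →
             ∃[ ℓ ] (2 ≤ ℓ × ℓ ≤ r ×
               Σ (Path M ℓ u v) λ p → InternalIn p (λ w → w ∈ B i × w ∉ C i))

{-# OPTIONS --safe #-}
-- Were M pattern-free, for each ℓ there would be a bound n(ℓ) on the (ℓ+1)-subdivided cliques
-- induced in φ_ℓ(M̂), where φ_ℓ(x,y) says that x, y are adjacent and lie on consecutive levels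
-- modulo ℓ+2, the levels being marked by unary predicates. Take |A| = k so large that Ramsey's
-- theorem applies to the colouring of the pairs x < y of A by the length (between 2 and r) of the
-- path joining f(x) and f(y) through B_⟨x,y⟩ ∖ C_⟨x,y⟩, where ⟨x,y⟩ is an injective pairing:
-- it yields n(ℓ) vertices of A whose pairs all carry the same length ℓ. These vertices as branch
-- vertices, together with the paths (endpoints included) as subdivided edges, form an induced
-- (ℓ+1)-subdivision of K_n(ℓ) in φ_ℓ(M̂) for the levels of this embedding: the matchings (ii)
-- provide the edges to the branch vertices, and (ii)–(iv) together with ℓ ≥ 2 exclude all others.
module Submission where

open import Defs renaming (sym to E-sym)
open import Data.Nat using (ℕ; zero; suc; _+_; _*_; _≤_; _<_; z≤n; s≤s; _≟_; _≤?_)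
open import Data.Nat.Properties
  using ( ≤-refl; ≤-reflexive; ≤-trans; ≤-pred; n≤1+n; m≤m+n; m≤n+m; m<n⇒m<1+n; <-irrefl; suc-injective
        ; +-mono-≤; +-mono-<-≤; +-mono-≤-<; +-monoˡ-≤; +-cancelˡ-≤; +-identityʳ; ≤∧≢⇒<; ≰⇒>)
open import Data.Fin using (Fin; toℕ; fromℕ; fromℕ<; inject₁; inject≤; combine)
import Data.Fin as F
open import Data.Fin.Properties
  using ( toℕ-injective; toℕ-fromℕ; toℕ-inject₁; toℕ-fromℕ<; toℕ-inject≤; toℕ<n
        ; inject≤-injective; combine-injective)
import Data.Fin.Properties as Fin
open import Data.Product using (Σ; ∃-syntax; _×_; _,_; proj₁; proj₂; uncurry)
import Data.Product as Product
open import Data.Sum using (inj₁; inj₂)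
import Data.Sum as Sum
open import Data.Empty using (⊥-elim)
import Data.Unit.Polymorphic as Unit
open import Data.List using (List; []; _∷_; length; filter; allFin)
open import Data.List.Properties using (length-tabulate; filter-accept; filter-reject)
import Data.List.Relation.Unary.All as All
open import Data.List.Relation.Unary.All using (All; []; _∷_)
open import Data.List.Relation.Unary.Any using (here; there)
open import Data.List.Relation.Unary.AllPairs using (AllPairs; []; _∷_)
import Data.List.Relation.Unary.AllPairs.Properties as AllPairs
open import Data.List.Membership.Propositional using (_∈_; _∉_)
open import Data.List.Membership.Propositional.Properties using (∈-filter⁻)
open import Relation.Nullary using (¬_; yes; no; contradiction)
open import Relation.Binary using (tri<; tri≈; tri>)
open import Relation.Binary.PropositionalEquality using (_≡_; _≢_; refl; sym; trans; cong; subst; subst₂)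
open import Function using (_∘_)
open import Function.Definitions using (Injective)

sumBelow : ℕ → (ℕ → ℕ) → ℕ
sumBelow zero    F = 0
sumBelow (suc d) F = F d + sumBelow d F

sumBelow-mono : ∀ d {F G} → (∀ i → F i ≤ G i) → sumBelow d F ≤ sumBelow d G
sumBelow-mono zero    F≤G = z≤n
sumBelow-mono (suc d) F≤G = +-mono-≤ (F≤G d) (sumBelow-mono d F≤G)

sumBelow-mono-< : ∀ d {F G} i → i < d → F i < G i → (∀ j → F j ≤ G j) → sumBelow d F < sumBelow d G
sumBelow-mono-< (suc d) i i<1+d Fi<Gi F≤G with i ≟ d
... | yes refl = +-mono-<-≤ Fi<Gi (sumBelow-mono d F≤G)
... | no  i≢d  = +-mono-≤-< (F≤G d) (sumBelow-mono-< d i (≤∧≢⇒< (≤-pred i<1+d) i≢d) Fi<Gi F≤G)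

≤-sumBelow : ∀ d F {i} → i < d → F i ≤ sumBelow d F
≤-sumBelow (suc d) F {i} i<1+d with i ≟ d
... | yes refl = m≤m+n (F i) _
... | no  i≢d  = ≤-trans (≤-sumBelow d F (≤∧≢⇒< (≤-pred i<1+d) i≢d)) (m≤n+m _ (F d))

averaging : ∀ c b F → suc c * b ≤ sumBelow (suc c) F → ∃[ i ] i < suc c × b ≤ F i
averaging zero    b F le = 0 , s≤s z≤n , subst₂ _≤_ (+-identityʳ b) (+-identityʳ (F 0)) le
averaging (suc c) b F le with b ≤? F (suc c)
... | yes b≤F = suc c , ≤-refl , b≤F
... | no  b≰F with averaging c b F rest
  where
  rest : suc c * b ≤ sumBelow (suc c) F
  rest = +-cancelˡ-≤ (F (suc c)) _ _ (≤-trans (+-monoˡ-≤ _ (≤-trans (n≤1+n _) (≰⇒> b≰F))) le)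
... | i , i<1+c , b≤Fi = i , m<n⇒m<1+n i<1+c , b≤Fi

module _ {A : Set} (colour : A → ℕ) where

  colourClass : ℕ → List A → List A
  colourClass i = filter (λ y → colour y ≟ i)

  ∈-colourClass⁻ : ∀ {i y} xs → y ∈ colourClass i xs → y ∈ xs × colour y ≡ i
  ∈-colourClass⁻ {i} xs = ∈-filter⁻ (λ z → colour z ≟ i) {xs = xs}

  classSize : List A → ℕ → ℕ
  classSize xs i = length (colourClass i xs)

  classSize-∷ : ∀ y ys i → classSize ys i ≤ classSize (y ∷ ys) i
  classSize-∷ y ys i with colour y ≟ i
  ... | yes y∈i =
    subst (λ l → classSize ys i ≤ length l) (sym (filter-accept (λ z → colour z ≟ i) y∈i)) (n≤1+n _)
  ... | no  y∉i = ≤-reflexive (cong length (sym (filter-reject (λ z → colour z ≟ i) y∉i)))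

  classSize-∷-own : ∀ y ys → classSize ys (colour y) < classSize (y ∷ ys) (colour y)
  classSize-∷-own y ys = ≤-reflexive (cong length (sym (filter-accept (λ z → colour z ≟ colour y) refl)))

  length≤sum-classSizes : ∀ d xs → All (λ y → colour y < d) xs → length xs ≤ sumBelow d (classSize xs)
  length≤sum-classSizes d []       _              = z≤n
  length≤sum-classSizes d (y ∷ ys) (y<d ∷ ys<d) =
    ≤-trans (s≤s (length≤sum-classSizes d ys ys<d))
            (sumBelow-mono-< d (colour y) y<d (classSize-∷-own y ys) (classSize-∷ y ys))

  pigeonhole : ∀ c b xs → All (λ y → colour y < suc c) xs → suc c * b ≤ length xs →
               ∃[ i ] i < suc c × b ≤ length (colourClass i xs)
  pigeonhole c b xs xs<c le = averaging c b (classSize xs) (≤-trans le (length≤sum-classSizes (suc c) xs xs<c))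

orderedFamily : ∀ {A : Set} {R : A → A → Set} N xs → AllPairs R xs → N ≤ length xs →
                Σ (Fin N → A) λ g → (∀ p → g p ∈ xs) × (∀ {p q} → p F.< q → R (g p) (g q))
orderedFamily zero    xs       _           _         = (λ ()) , (λ ()) , λ { {()} }
orderedFamily {A} {R} (suc N) (x ∷ xs) (x≺xs ∷ xs↑) (s≤s N≤) with orderedFamily N xs xs↑ N≤
... | g , g∈xs , g↑ = family , family∈ , family↑
  where
  family : Fin (suc N) → A
  family F.zero    = x
  family (F.suc p) = g p

  family∈ : ∀ p → family p ∈ (x ∷ xs)
  family∈ F.zero    = here refl
  family∈ (F.suc p) = there (g∈xs p)

  family↑ : ∀ {p q} → p F.< q → R (family p) (family q)
  family↑ {F.zero}  {F.suc q} _         = All.lookup x≺xs (g∈xs q)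
  family↑ {F.suc p} {F.suc q} (s≤s p<q) = g↑ p<q

-- Pigeonhole on the colours towards the first element leaves a class of ramseyBound c m
-- elements, from which the rest of a greedy chain of length m + 1 is chosen.
ramseyBound : ℕ → ℕ → ℕ
ramseyBound c zero    = 0
ramseyBound c (suc m) = suc (suc c * ramseyBound c m)

module Greedy {A : Set} {_≺_ : A → A → Set} (c : ℕ) (χ : A → A → ℕ) (χ<1+c : ∀ x y → χ x y < suc c)
  where

  Dominates : A × ℕ → A × ℕ → Set
  Dominates (x , i) (y , _) = x ≺ y × χ x y ≡ i

  greedyChain : ∀ m L → AllPairs _≺_ L → ramseyBound c m ≤ length L →
                Σ (List (A × ℕ)) λ S → length S ≡ m × AllPairs Dominates S ×
                  All (λ e → proj₁ e ∈ L) S × All (λ e → proj₂ e < suc c) S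
  greedyChain zero    L        _            _         = [] , refl , [] , [] , []
  greedyChain (suc m) (x ∷ xs) (x≺xs ∷ xs↑) (s≤s b≤)
    with pigeonhole (χ x) c (ramseyBound c m) xs (All.tabulate (λ {y} _ → χ<1+c x y)) b≤
  ... | i , i<1+c , b≤class with greedyChain m (colourClass (χ x) i xs) (AllPairs.filter⁺ _ xs↑) b≤class
  ... | S , |S| , S↑ , S⊆class , S<1+c =
        (x , i) ∷ S
      , cong suc |S|
      , All.map (λ {e} → dominated {e}) S⊆class ∷ S↑
      , here refl ∷ All.map (there ∘ proj₁ ∘ inClass) S⊆class
      , i<1+c ∷ S<1+c
    where
    inClass : ∀ {y} → y ∈ colourClass (χ x) i xs → y ∈ xs × χ x y ≡ i
    inClass = ∈-colourClass⁻ (χ x) xs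

    dominated : ∀ {e} → proj₁ e ∈ colourClass (χ x) i xs → Dominates (x , i) e
    dominated e∈ = All.lookup x≺xs (proj₁ (inClass e∈)) , proj₂ (inClass e∈)

Monochromatic : ∀ {K} → (Fin K → Fin K → ℕ) → ℕ → ℕ → Set
Monochromatic {K} χ N i = Σ (Fin N → Fin K) λ g → ∀ {p q} → p F.< q → g p F.< g q × χ (g p) (g q) ≡ i

ramsey : ∀ c N → ∃[ K ] ∀ (χ : Fin K → Fin K → ℕ) → (∀ x y → χ x y < suc c) →
         ∃[ i ] i < suc c × Monochromatic χ N i
ramsey c N = K , monochromatic
  where
  K : ℕ
  K = ramseyBound c (suc c * N)

  monochromatic : ∀ (χ : Fin K → Fin K → ℕ) → (∀ x y → χ x y < suc c) →
                  ∃[ i ] i < suc c × Monochromatic χ N i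
  monochromatic χ χ<1+c
    with Greedy.greedyChain c χ χ<1+c (suc c * N) (allFin K)
           (AllPairs.tabulate⁺-< (λ p<q → p<q)) (≤-reflexive (sym (length-tabulate (λ x → x))))
  ... | S , |S| , S↑ , _ , S<1+c with pigeonhole proj₂ c N S S<1+c (≤-reflexive (sym |S|))
  ... | i , i<1+c , N≤class with orderedFamily N (colourClass proj₂ i S) (AllPairs.filter⁺ _ S↑) N≤class
  ... | G , G∈class , G↑ = i , i<1+c , (λ p → proj₁ (G p)) , λ {p} {q} p<q →
          proj₁ (G↑ p<q) , trans (proj₂ (G↑ p<q)) (proj₂ (∈-colourClass⁻ proj₂ S (G∈class p)))

bigOr : ∀ {m} n → (Fin n → QF m) → QF m
bigOr zero    φ = ff
bigOr (suc n) φ = φ F.zero or bigOr n (λ j → φ (F.suc j))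

module _ (M : Graph) {m} (P : Expansion M m) where

  sat-bigOr⁻ : ∀ n (φ : Fin n → QF m) ρ → Sat M P (bigOr n φ) ρ → ∃[ j ] Sat M P (φ j) ρ
  sat-bigOr⁻ (suc n) φ ρ (inj₁ sat) = F.zero , sat
  sat-bigOr⁻ (suc n) φ ρ (inj₂ sat) with sat-bigOr⁻ n (λ j → φ (F.suc j)) ρ sat
  ... | j , satj = F.suc j , satj

  sat-bigOr⁺ : ∀ n (φ : Fin n → QF m) ρ j → Sat M P (φ j) ρ → Sat M P (bigOr n φ) ρ
  sat-bigOr⁺ (suc n) φ ρ F.zero    sat = inj₁ sat
  sat-bigOr⁺ (suc n) φ ρ (F.suc j) sat = inj₂ (sat-bigOr⁺ n (λ j → φ (F.suc j)) ρ j sat)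

𝑥 𝑦 : Fin 2
𝑥 = F.zero
𝑦 = F.suc F.zero

levelStep : ∀ {s} → Fin s → QF (suc s)
levelStep j = predA (inject₁ j) 𝑥 and predA (F.suc j) 𝑦

-- E(x,y) ∧ ⋁_{j ≤ s} Pⱼ(x) ∧ P_{j+1 mod s+1}(y). Along each edge of the s-subdivision the levels
-- 0 (branch vertex), 1, …, s (subdivision vertices), 0 are consecutive modulo s + 1.
cyclicEdge : (s : ℕ) → QF (suc s)
cyclicEdge s = edgeA 𝑥 𝑦 and (bigOr s levelStep or (predA (fromℕ s) 𝑥 and predA F.zero 𝑦))

data CyclicSucc (s : ℕ) (i j : ℕ) : Set where
  step : i < s → suc i ≡ j → CyclicSucc s i j
  wrap : i ≡ s → j ≡ 0 → CyclicSucc s i j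

level : ∀ {n s} → SubV n s → ℕ
level (br _)        = 0
level (sub _ _ _ t) = suc (toℕ t)

data Position (ℓ : ℕ) : Fin (suc ℓ) → Set where
  start : Position ℓ F.zero
  end   : Position ℓ (fromℕ ℓ)
  inner : ∀ {t} → 0 < toℕ t → toℕ t < ℓ → Position ℓ t

position : ∀ ℓ t → Position ℓ t
position ℓ F.zero    = start
position ℓ (F.suc t) with toℕ (F.suc t) ≟ ℓ
... | yes t≡ℓ = subst (Position ℓ) (sym (toℕ-injective (trans t≡ℓ (sym (toℕ-fromℕ ℓ))))) end
... | no  t≢ℓ = inner (s≤s z≤n) (≤∧≢⇒< (≤-pred (toℕ<n (F.suc t))) t≢ℓ)

toℕ≡0⇒≡zero : ∀ {ℓ} (t : Fin (suc ℓ)) → toℕ t ≡ 0 → t ≡ F.zero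
toℕ≡0⇒≡zero F.zero _ = refl

toℕ≡ℓ⇒≡fromℕ : ∀ {ℓ} (t : Fin (suc ℓ)) → toℕ t ≡ ℓ → t ≡ fromℕ ℓ
toℕ≡ℓ⇒≡fromℕ {ℓ} t t≡ℓ = toℕ-injective (trans t≡ℓ (sym (toℕ-fromℕ ℓ)))

module _ {r : ℕ} {M : Graph} {k : ℕ} (cf : Config r M k) where
  open Config cf

  B∖C : ℕ → V M → Set
  B∖C i w = w ∈ B i × w ∉ C i

  record Gadgets (n ℓ : ℕ) : Set where
    field
      branch      : Fin n → Fin k
      branch-inj  : Injective _≡_ _≡_ branch
      index       : Fin n → Fin n → ℕ
      index-inj   : ∀ {p q p' q'} → p F.< q → p' F.< q' → index p q ≡ index p' q' → p ≡ p' × q ≡ q'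
      path        : ∀ {p q} → p F.< q → Path M ℓ (f (index p q) (branch p)) (f (index p q) (branch q))
      path-inside : ∀ {p q} (p<q : p F.< q) → InternalIn (path p<q) (B∖C (index p q))
      2≤ℓ         : 2 ≤ ℓ

  restrictGadgets : ∀ {n N ℓ} → n ≤ N → Gadgets N ℓ → Gadgets n ℓ
  restrictGadgets {n} {N} n≤N G = record
    { branch      = branch ∘ inject
    ; branch-inj  = inject-inj ∘ branch-inj
    ; index       = λ p q → index (inject p) (inject q)
    ; index-inj   = λ p<q p'<q' eq → Product.map inject-inj inject-inj
                                       (index-inj (inject-mono p<q) (inject-mono p'<q') eq)
    ; path        = path ∘ inject-mono
    ; path-inside = path-inside ∘ inject-mono
    ; 2≤ℓ         = 2≤ℓ
    }
    where
    open Gadgets G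
    inject : Fin n → Fin N
    inject p = inject≤ p n≤N

    inject-inj : Injective _≡_ _≡_ inject
    inject-inj = inject≤-injective n≤N n≤N _ _

    inject-mono : ∀ {p q} → p F.< q → inject p F.< inject q
    inject-mono {p} {q} = subst₂ _<_ (sym (toℕ-inject≤ p n≤N)) (sym (toℕ-inject≤ q n≤N))

module SubdivisionEmbedding {r : ℕ} {M : Graph} {k : ℕ} {cf : Config r M k} {n ℓ : ℕ} (G : Gadgets cf n ℓ)
  where
  open Config cf
  open Gadgets G

  s : ℕ
  s = suc ℓ

  vertex : ∀ {p q} → p F.< q → Fin s → V M
  vertex p<q = Path.vtx (path p<q)

  embedding : SubV n s → V M
  embedding (br p)          = a (branch p)
  embedding (sub _ _ p<q t) = vertex p<q t

  vertex-start : ∀ {p q} (p<q : p F.< q) → vertex p<q F.zero ≡ f (index p q) (branch p)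
  vertex-start p<q = Path.start (path p<q)

  vertex-end : ∀ {p q} (p<q : p F.< q) → vertex p<q (fromℕ ℓ) ≡ f (index p q) (branch q)
  vertex-end p<q = Path.end (path p<q)

  vertex∈B : ∀ {p q} (p<q : p F.< q) t → vertex p<q t ∈ B (index p q)
  vertex∈B {p} {q} p<q t with position ℓ t
  ... | start       = subst (_∈ B _) (sym (vertex-start p<q)) (C⊆B _ (f-into _ (branch p)))
  ... | end         = subst (_∈ B _) (sym (vertex-end p<q)) (C⊆B _ (f-into _ (branch q)))
  ... | inner 0<t t<ℓ = proj₁ (path-inside p<q t 0<t t<ℓ)

  embedding-inj : Injective _≡_ _≡_ embedding
  embedding-inj {br p}          {br q}              eq = cong br (branch-inj (a-inj eq))
  embedding-inj {br p}          {sub _ _ p<q t}     eq =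
    ⊥-elim (A∩B _ (branch p) (subst (_∈ B _) (sym eq) (vertex∈B p<q t)))
  embedding-inj {sub _ _ p<q t} {br p}              eq =
    ⊥-elim (A∩B _ (branch p) (subst (_∈ B _) eq (vertex∈B p<q t)))
  embedding-inj {sub p q p<q t} {sub p' q' p'<q' t'} eq with index p q ≟ index p' q'
  ... | no  i≢i' = ⊥-elim (B∩B _ _ i≢i' (vertex∈B p<q t) (subst (_∈ B _) (sym eq) (vertex∈B p'<q' t')))
  ... | yes i≡i' with index-inj p<q p'<q' i≡i'
  ... | refl , refl with Fin.<-irrelevant p<q p'<q'
  ... | refl = cong (sub p q p<q) (Path.inj (path p<q) eq)

  levels : Expansion M (suc s)
  levels j w = ∃[ u ] embedding u ≡ w × level u ≡ toℕ j

  sat-cyclicEdge⁻ : ∀ u v → Sat M levels (cyclicEdge s) [ embedding u , embedding v ] →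
                    E M (embedding u) (embedding v) × CyclicSucc s (level u) (level v)
  sat-cyclicEdge⁻ u v (uv , inj₁ sat) with sat-bigOr⁻ M levels s levelStep _ sat
  ... | j , (u' , u'↦u , u'∈j) , (v' , v'↦v , v'∈j+1)
    with embedding-inj {u'} {u} u'↦u | embedding-inj {v'} {v} v'↦v
  ... | refl | refl = uv , step (subst (_< s) (sym u∈j) (toℕ<n j)) (trans (cong suc u∈j) (sym v'∈j+1))
    where
    u∈j : level u' ≡ toℕ j
    u∈j = trans u'∈j (toℕ-inject₁ j)
  sat-cyclicEdge⁻ u v (uv , inj₂ ((u' , u'↦u , u'∈s) , (v' , v'↦v , v'∈0)))
    with embedding-inj {u'} {u} u'↦u | embedding-inj {v'} {v} v'↦v
  ... | refl | refl = uv , wrap (trans u'∈s (toℕ-fromℕ s)) v'∈0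

  sat-cyclicEdge⁺ : ∀ u v → E M (embedding u) (embedding v) → CyclicSucc s (level u) (level v) →
                    Sat M levels (cyclicEdge s) [ embedding u , embedding v ]
  sat-cyclicEdge⁺ u v uv (step u<s u+1≡v) =
    uv , inj₁ (sat-bigOr⁺ M levels s levelStep _ (fromℕ< u<s)
                ( (u , refl , sym (trans (toℕ-inject₁ (fromℕ< u<s)) (toℕ-fromℕ< u<s)))
                , (v , refl , trans (sym u+1≡v) (cong suc (sym (toℕ-fromℕ< u<s))))))
  sat-cyclicEdge⁺ u v uv (wrap u≡s v≡0) =
    uv , inj₂ ((u , refl , trans u≡s (sym (toℕ-fromℕ s))) , (v , refl , v≡0))

  branch-adjacent⁺ : ∀ {p q} (p<q : p F.< q) o → E M (a (branch o)) (f (index p q) (branch o))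
  branch-adjacent⁺ {p} {q} _ o = proj₂ (match (index p q) (branch o) (f-into _ (branch o))) refl

  branch-adjacent⁻ : ∀ {p q} (p<q : p F.< q) o o' → E M (a (branch o)) (f (index p q) (branch o')) → o' ≡ o
  branch-adjacent⁻ {p} {q} _ o o' e =
    branch-inj (f-inj _ (proj₁ (match (index p q) (branch o) (f-into _ (branch o'))) e))

  subArc⇒edge : ∀ {u v} → SubArc n s u v → E M (embedding u) (embedding v)
  subArc⇒edge (direct _ ())
  subArc⇒edge (first {i = p} {p = p<q} {t = t} t≡0) with toℕ≡0⇒≡zero t t≡0
  ... | refl = subst (E M _) (sym (vertex-start p<q)) (branch-adjacent⁺ p<q p)
  subArc⇒edge (mid {p = p<q} {t = t} {t' = t'} t+1≡t') = Path.adj (path p<q) t t' t+1≡t'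
  subArc⇒edge (last {j = q} {p = p<q} {t = t} t+1≡s) with toℕ≡ℓ⇒≡fromℕ t (suc-injective t+1≡s)
  ... | refl = E-sym M (subst (E M _) (sym (vertex-end p<q)) (branch-adjacent⁺ p<q q))

  subArc⇒cyclicSucc : ∀ {u v} → SubArc n s u v → CyclicSucc s (level u) (level v)
  subArc⇒cyclicSucc (direct _ ())
  subArc⇒cyclicSucc (first t≡0)            = step (s≤s z≤n) (cong suc (sym t≡0))
  subArc⇒cyclicSucc (mid {t' = t'} t+1≡t') = step (subst (_< s) (sym t+1≡t') (toℕ<n t')) (cong suc t+1≡t')
  subArc⇒cyclicSucc (last t+1≡s)           = wrap t+1≡s refl

  -- Condition (iv) excludes an edge at an inner path vertex, and position 1 is inner as ℓ ≥ 2.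
  noEdgeBetweenGadgets : ∀ {p q p' q'} (p<q : p F.< q) (p'<q' : p' F.< q') {t t'} →
                         index p q ≢ index p' q' → suc (toℕ t) ≡ toℕ t' →
                         ¬ E M (vertex p<q t) (vertex p'<q' t')
  noEdgeBetweenGadgets p<q p'<q' {t} {t'} i≢i' t+1≡t' uv with position ℓ t
  ... | inner 0<t t<ℓ =
    noBB _ _ i≢i' (vertex∈B p<q t) (proj₂ (path-inside p<q t 0<t t<ℓ)) (vertex∈B p'<q' t') uv
  ... | start =
    noBB _ _ (λ eq → i≢i' (sym eq)) (vertex∈B p'<q' t')
         (proj₂ (path-inside p'<q' t' (subst (0 <_) t+1≡t' (s≤s z≤n)) (subst (_< ℓ) t+1≡t' 2≤ℓ)))
         (vertex∈B p<q t) (E-sym M uv)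
  ... | end = <-irrefl (trans (sym t+1≡t') (cong suc (toℕ-fromℕ ℓ))) (toℕ<n t')

  edge⇒subEdge : ∀ u v → E M (embedding u) (embedding v) → CyclicSucc s (level u) (level v) → SubEdge n s u v
  edge⇒subEdge (br _) (br _) _ (step _ ())
  edge⇒subEdge (br _) (br _) _ (wrap () _)
  edge⇒subEdge (br _) (sub _ _ _ _) _ (wrap () _)
  edge⇒subEdge (br p) (sub p' _ p'<q' t) uv (step _ 1≡t+1) with toℕ≡0⇒≡zero t (sym (suc-injective 1≡t+1))
  ... | refl with branch-adjacent⁻ p'<q' p p' (subst (E M _) (vertex-start p'<q') uv)
  ... | refl = inj₁ (first refl)
  edge⇒subEdge (sub _ _ _ _) (br _) _ (step _ ())
  edge⇒subEdge (sub _ q p<q t) (br p') uv (wrap t+1≡s _) with toℕ≡ℓ⇒≡fromℕ t (suc-injective t+1≡s)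
  ... | refl with branch-adjacent⁻ p<q p' q (E-sym M (subst (λ w → E M w _) (vertex-end p<q) uv))
  ... | refl = inj₁ (last t+1≡s)
  edge⇒subEdge (sub _ _ _ _) (sub _ _ _ _) _ (wrap _ ())
  edge⇒subEdge (sub p q p<q t) (sub p' q' p'<q' t') uv (step _ t+2≡t'+1) with index p q ≟ index p' q'
  ... | no  i≢i' = ⊥-elim (noEdgeBetweenGadgets p<q p'<q' i≢i' (suc-injective t+2≡t'+1) uv)
  ... | yes i≡i' with index-inj p<q p'<q' i≡i'
  ... | refl , refl with Fin.<-irrelevant p<q p'<q'
  ... | refl = inj₁ (mid (suc-injective t+2≡t'+1))

  subdivision-induced : InducedSub (SubK n s) (interpG M levels (cyclicEdge s))
  subdivision-induced = embedding , embedding-inj , λ u v → preserve u v , reflect u v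
    where
    arc⇒sat : ∀ {u v} → SubArc n s u v → Sat M levels (cyclicEdge s) [ embedding u , embedding v ]
    arc⇒sat {u} {v} uv = sat-cyclicEdge⁺ u v (subArc⇒edge uv) (subArc⇒cyclicSucc uv)

    preserve : ∀ u v → SubEdge n s u v → E (interpG M levels (cyclicEdge s)) (embedding u) (embedding v)
    preserve u v uv = (λ eq → irrefl (SubK n s) (subst (SubEdge n s u) (sym (embedding-inj eq)) uv))
                    , Sum.map arc⇒sat arc⇒sat uv

    reflect : ∀ u v → E (interpG M levels (cyclicEdge s)) (embedding u) (embedding v) → SubEdge n s u v
    reflect u v (_ , inj₁ sat) = uncurry (edge⇒subEdge u v) (sat-cyclicEdge⁻ u v sat)
    reflect u v (_ , inj₂ sat) = Sum.swap (uncurry (edge⇒subEdge v u) (sat-cyclicEdge⁻ v u sat))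

strictlyIncreasing⇒injective : ∀ {N K} (g : Fin N → Fin K) → (∀ {p q} → p F.< q → g p F.< g q) →
                               Injective _≡_ _≡_ g
strictlyIncreasing⇒injective g g↑ {p} {q} gp≡gq with Fin.<-cmp p q
... | tri< p<q _ _ = contradiction gp≡gq (Fin.<⇒≢ (g↑ p<q))
... | tri≈ _ p≡q _ = p≡q
... | tri> _ _ q<p = contradiction (sym gp≡gq) (Fin.<⇒≢ (g↑ q<p))

module PairGadgets {r : ℕ} {M : Graph} {K : ℕ} (2≤r : 2 ≤ r) (cf : Config r M K) where
  open Config cf

  pairIndex : Fin K → Fin K → ℕ
  pairIndex x y = toℕ (combine x y)

  GadgetPath : Fin K → Fin K → ℕ → Set
  GadgetPath x y ℓ = Σ (Path M ℓ (f (pairIndex x y) x) (f (pairIndex x y) y)) λ π →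
                       InternalIn π (B∖C cf (pairIndex x y))

  -- Pairs x ≥ y are given the junk length r, so that every pair has a length in [2, r].
  gadgetPath : ∀ x y → ∃[ ℓ ] 2 ≤ ℓ × ℓ ≤ r × (x F.< y → GadgetPath x y ℓ)
  gadgetPath x y with x Fin.<? y
  ... | yes x<y = Product.map₂ (Product.map₂ (Product.map₂ (λ π _ → π)))
                    (paths (pairIndex x y) (f-into _ x) (f-into _ y) (Fin.<⇒≢ x<y ∘ f-inj _))
  ... | no  x≮y = r , 2≤r , ≤-refl , λ x<y → contradiction x<y x≮y

  gadgetLength : Fin K → Fin K → ℕ
  gadgetLength x y = proj₁ (gadgetPath x y)

  gadgetLength<1+r : ∀ x y → gadgetLength x y < suc r
  gadgetLength<1+r x y = s≤s (proj₁ (proj₂ (proj₂ (gadgetPath x y))))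

  monochromaticGadgets : ∀ {N ℓ} → 2 ≤ ℓ → Monochromatic gadgetLength N ℓ → Gadgets cf N ℓ
  monochromaticGadgets {N} {ℓ} 2≤ℓ (g , mono) = record
    { branch      = g
    ; branch-inj  = g-inj
    ; index       = λ p q → pairIndex (g p) (g q)
    ; index-inj   = λ _ _ eq → Product.map g-inj g-inj (combine-injective _ _ _ _ (toℕ-injective eq))
    ; path        = λ p<q → proj₁ (gadget p<q)
    ; path-inside = λ p<q → proj₂ (gadget p<q)
    ; 2≤ℓ         = 2≤ℓ
    }
    where
    g-inj : Injective _≡_ _≡_ g
    g-inj = strictlyIncreasing⇒injective g (proj₁ ∘ mono)

    gadget : ∀ {p q} → p F.< q → GadgetPath (g p) (g q) ℓ
    gadget {p} {q} p<q = subst (GadgetPath (g p) (g q)) (proj₂ (mono p<q))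
                           (proj₂ (proj₂ (proj₂ (gadgetPath (g p) (g q)))) (proj₁ (mono p<q)))

module _ {r : ℕ} (2≤r : 2 ≤ r) {M : Graph} (configs : (k : ℕ) → Config r M k) (size : ℕ → ℕ) where

  -- Two spare vertices make the monochromatic set contain a pair, whose length is at least 2.
  private
    N : ℕ
    N = 2 + sumBelow (suc r) size

  uniformGadgets : ∃[ k ] ∃[ ℓ ] Gadgets (configs k) (size ℓ) ℓ
  uniformGadgets = K , fromMonochromatic (proj₂ (ramsey r N) gadgetLength gadgetLength<1+r)
    where
    K : ℕ
    K = proj₁ (ramsey r N)

    open PairGadgets 2≤r (configs K)

    fromMonochromatic : ∃[ ℓ ] ℓ < suc r × Monochromatic gadgetLength N ℓ →
                        ∃[ ℓ ] Gadgets (configs K) (size ℓ) ℓ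
    fromMonochromatic (ℓ , ℓ<1+r , g , mono) =
      ℓ , restrictGadgets (configs K) size≤N (monochromaticGadgets 2≤ℓ (g , mono))
      where
      size≤N : size ℓ ≤ N
      size≤N = ≤-trans (≤-sumBelow (suc r) size ℓ<1+r) (m≤n+m _ 2)

      2≤ℓ : 2 ≤ ℓ
      2≤ℓ = subst (2 ≤_) (proj₂ (mono {F.zero} {F.suc F.zero} (s≤s z≤n)))
                  (proj₁ (proj₂ (gadgetPath (g F.zero) (g (F.suc F.zero)))))

module _ {M : Graph} (pf : PatternFree M) where

  private
    cyclicEdgeFree : ∀ ℓ → ∃[ n ] ((P : Expansion M (suc (suc ℓ))) → Unit.⊤ →
                                   ¬ InducedSub (SubK n (suc ℓ)) (interpG M P (cyclicEdge (suc ℓ))))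
    cyclicEdgeFree ℓ = pf (suc ℓ) (s≤s z≤n) (suc (suc ℓ)) (λ _ → Unit.⊤) (cyclicEdge (suc ℓ))

  cyclicEdgeBound : ℕ → ℕ
  cyclicEdgeBound ℓ = proj₁ (cyclicEdgeFree ℓ)

  noCyclicEdgeSubdivision : ∀ ℓ (P : Expansion M (suc (suc ℓ))) →
                            ¬ InducedSub (SubK (cyclicEdgeBound ℓ) (suc ℓ)) (interpG M P (cyclicEdge (suc ℓ)))
  noCyclicEdgeSubdivision ℓ P = proj₂ (cyclicEdgeFree ℓ) P Unit.tt

mainTheorem14 : (r : ℕ) → 2 ≤ r → (M : Graph) →
    ((k : ℕ) → Config r M k) → ¬ PatternFree M
mainTheorem14 r 2≤r M configs pf =
  let (_ , ℓ , G) = uniformGadgets 2≤r configs (cyclicEdgeBound pf)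
      open SubdivisionEmbedding G
  in noCyclicEdgeSubdivision pf ℓ levels subdivision-induced
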